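{- In the linear multirole logic LMRL over a set of roles $\mathcal{R}$, for every formula $A$ the sequent $\vdash[\mathcal{R}]A$ (consisting of the single i-formula $[\mathcal{R}]A$) is derivable.
   Context: Fix a set $\mathcal{R}$ (the set of roles), possibly infinite. For $R\subseteq\mathcal{R}$ write $\overline{R}=\mathcal{R}\setminus R$; $R_1\uplus\cdots\uplus R_n$ denotes the union of pairwise disjoint sets. A filter on $\mathcal{R}$ is a set $\mathcal{F}$ of subsets of $\mathcal{R}$ with $\mathcal{R}\in\mathcal{F}$, upward closed under inclusion, and closed under binary intersection; an ultrafilter $\mathcal{U}$ is a filter such that for every $R\subseteq\mathcal{R}$, $R\in\mathcal{U}$ or $\overline{R}\in\mathcal{U}$. An endomorphism is any $f:\mathcal{R}\to\mathcal{R}$; $f^{ -1}(R)$ is the preimage. Terms $t$, atomic formulas $a$ are standard first-order. Formulas of LMRL: $A ::= a \mid \neg_f(A) \mid A_1\wedge_{\mathcal{U}}A_2 \mid A\supset_{f,\mathcal{U}}B \mid (!A)_{\mathcal{U}} \mid \forall_{\mathcal{U}}(\lambda x.A)$ ($f$ endomorphism, $\mathcal{U}$ ultrafilter); $A[x:=t]$ is substitution. An i-formula is $[R]A$ with $R\subseteq\mathcal{R}$; a sequent $\Gamma$ is a finite multiset of i-formulas, commas denoting multiset union. $?(\Gamma)$ denotes a sequent each of whose i-formulas has the form $[R'](!B)_{\mathcal{U}'}$ with $R'\notin\mathcal{U}'$. Derivable sequents are generated by: (Id) $\vdash[R_1]a,\dots,[R_n]a$ for atomic $a$, $n\ge1$,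 $R_1\uplus\cdots\uplus R_n=\mathcal{R}$; ($\neg$) from $\vdash\Gamma,[f^{ -1}(R)]A$ infer $\vdash\Gamma,[R]\neg_f(A)$; ($\supset$-neg) if $R\notin\mathcal{U}$, from $\vdash\Gamma,[f^{ -1}(R)]A,[R]B$ infer $\vdash\Gamma,[R](A\supset_{f,\mathcal{U}}B)$; ($\supset$-pos) if $R\in\mathcal{U}$, from $\vdash\Gamma_1,[f^{ -1}(R)]A$ and $\vdash\Gamma_2,[R]B$ infer $\vdash\Gamma_1,\Gamma_2,[R](A\supset_{f,\mathcal{U}}B)$; ($\wedge$-neg) if $R\notin\mathcal{U}$, from $\vdash\Gamma,[R]A$ or from $\vdash\Gamma,[R]B$ infer $\vdash\Gamma,[R](A\wedge_{\mathcal{U}}B)$; ($\wedge$-pos) if $R\in\mathcal{U}$, from $\vdash\Gamma,[R]A$ and $\vdash\Gamma,[R]B$ infer $\vdash\Gamma,[R](A\wedge_{\mathcal{U}}B)$; ($!$-pos) if $R\in\mathcal{U}$, from $\vdash ?(\Gamma),[R]A$ infer $\vdash ?(\Gamma),[R](!A)_{\mathcal{U}}$; ($!$-neg-weaken) if $R\notin\mathcal{U}$, from $\vdash\Gamma$ infer $\vdash\Gamma,[R](!A)_{\mathcal{U}}$; ($!$-neg-derelict) if $R\notin\mathcal{U}$, from $\vdash\Gamma,[R]A$ infer $\vdash\Gamma,[R](!A)_{\mathcal{U}}$; ($!$-neg-contract) if $R\notin\mathcal{U}$, from $\vdash\Gamma,[R](!A)_{\mathcal{U}},[R](!A)_{\mathcal{U}}$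 infer $\vdash\Gamma,[R](!A)_{\mathcal{U}}$; ($\forall$-neg) if $R\notin\mathcal{U}$, from $\vdash\Gamma,[R]A[x:=t]$ infer $\vdash\Gamma,[R]\forall_{\mathcal{U}}(\lambda x.A)$; ($\forall$-pos) if $R\in\mathcal{U}$ and $x$ not free in $\Gamma$, from $\vdash\Gamma,[R]A$ infer $\vdash\Gamma,[R]\forall_{\mathcal{U}}(\lambda x.A)$. -}

module Defs where

open import Data.Nat using (ℕ; zero; suc)
open import Data.Fin using (Fin; zero; suc)
open import Data.List using (List; []; _∷_; _++_; [_]; map)
open import Data.List.Relation.Unary.All using (All)
open import Data.List.Relation.Unary.Any using (Any)
open import Data.List.Relation.Unary.AllPairs using (AllPairs)
open import Data.List.Relation.Binary.Permutation.Propositional using (_↭_)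
open import Data.Empty using (⊥)
open import Data.Unit using (⊤)
open import Data.Product using (_×_)
open import Data.Sum using (_⊎_)
open import Relation.Nullary using (¬_)

data Term (n : ℕ) : Set where
  var : Fin n → Term n
  fun : ℕ → List (Term n) → Term n

data Atom (n : ℕ) : Set where
  pred : ℕ → List (Term n) → Atom n

mutual
  renT : ∀ {n m} → (Fin n → Fin m) → Term n → Term m
  renT ρ (var i) = var (ρ i)
  renT ρ (fun f ts) = fun f (renTs ρ ts)

  renTs : ∀ {n m} → (Fin n → Fin m) → List (Term n) → List (Term m)
  renTs ρ [] = []
  renTs ρ (t ∷ ts) = renT ρ t ∷ renTs ρ ts

mutual
  subT : ∀ {n m} → (Fin n → Term m) → Term n → Term m
  subT σ (var i) = σ i
  subT σ (fun f ts) = fun f (subTs σ ts)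

  subTs : ∀ {n m} → (Fin n → Term m) → List (Term n) → List (Term m)
  subTs σ [] = []
  subTs σ (t ∷ ts) = subT σ t ∷ subTs σ ts

ext : ∀ {n m} → (Fin n → Fin m) → Fin (suc n) → Fin (suc m)
ext ρ zero = zero
ext ρ (suc i) = suc (ρ i)

exts : ∀ {n m} → (Fin n → Term m) → Fin (suc n) → Term (suc m)
exts σ zero = var zero
exts σ (suc i) = renT suc (σ i)

module _ (𝓡 : Set) where

  Roles : Set₁
  Roles = 𝓡 → Set

  Full : Roles
  Full _ = ⊤

  Compl : Roles → Roles
  Compl R r = ¬ R r

  _∩R_ : Roles → Roles → Roles
  (R ∩R S) r = R r × S r

  _⊆R_ : Roles → Roles → Set
  R ⊆R S = ∀ r → R r → S r

  preimage : (𝓡 → 𝓡) → Roles → Roles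
  preimage f R r = R (f r)

  record Ultrafilter : Set₁ where
    field
      _∈U     : Roles → Set
      full    : Full ∈U
      up      : ∀ R S → R ⊆R S → R ∈U → S ∈U
      inter   : ∀ R S → R ∈U → S ∈U → (R ∩R S) ∈U
      ultra   : ∀ R → R ∈U ⊎ Compl R ∈U

  open Ultrafilter public

  data Formula (n : ℕ) : Set₁ where
    atom : Atom n → Formula n
    neg  : (𝓡 → 𝓡) → Formula n → Formula n
    and  : Ultrafilter → Formula n → Formula n → Formula n
    imp  : (𝓡 → 𝓡) → Ultrafilter → Formula n → Formula n → Formula n
    bang : Ultrafilter → Formula n → Formula n
    all  : Ultrafilter → Formula (suc n) → Formula n

  renF : ∀ {n m} → (Fin n → Fin m) → Formula n → Formula m
  renF ρ (atom (pred p ts)) = atom (pred p (renTs ρ ts))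
  renF ρ (neg f A) = neg f (renF ρ A)
  renF ρ (and U A B) = and U (renF ρ A) (renF ρ B)
  renF ρ (imp f U A B) = imp f U (renF ρ A) (renF ρ B)
  renF ρ (bang U A) = bang U (renF ρ A)
  renF ρ (all U A) = all U (renF (ext ρ) A)

  subF : ∀ {n m} → (Fin n → Term m) → Formula n → Formula m
  subF σ (atom (pred p ts)) = atom (pred p (subTs σ ts))
  subF σ (neg f A) = neg f (subF σ A)
  subF σ (and U A B) = and U (subF σ A) (subF σ B)
  subF σ (imp f U A B) = imp f U (subF σ A) (subF σ B)
  subF σ (bang U A) = bang U (subF σ A)
  subF σ (all U A) = all U (subF (exts σ) A)

  single : ∀ {n} → Term n → Fin (suc n) → Term n
  single t zero = t
  single t (suc i) = var i

  _[0:=_] : ∀ {n} → Formula (suc n) → Term n → Formula n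
  A [0:= t ] = subF (single t) A

  -- i-formulas and sequents (multisets represented as lists + exchange)

  record IFormula (n : ℕ) : Set₁ where
    constructor ⟨_⟩_
    field
      roles   : Roles
      formula : Formula n

  Sequent : ℕ → Set₁
  Sequent n = List (IFormula n)

  wkI : ∀ {n} → IFormula n → IFormula (suc n)
  wkI (⟨ R ⟩ A) = ⟨ R ⟩ renF suc A

  wkSeq : ∀ {n} → Sequent n → Sequent (suc n)
  wkSeq = map wkI

  data IsWhyNot {n : ℕ} : IFormula n → Set₁ where
    whyNot : ∀ {R U B} → ¬ (U ∈U) R → IsWhyNot (⟨ R ⟩ bang U B)

  WhyNot : ∀ {n} → Sequent n → Set₁
  WhyNot Γ = All IsWhyNot Γ

  data NonEmpty {A : Set₁} : List A → Set₁ where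
    nonEmpty : ∀ {x xs} → NonEmpty (x ∷ xs)

  record Partition (Rs : List Roles) : Set₁ where
    field
      nonempty : NonEmpty Rs
      disjoint : AllPairs (λ R S → ∀ r → R r → S r → ⊥) Rs
      covers   : ∀ r → Any (λ R → R r) Rs

  idSeq : ∀ {n} → Atom n → List Roles → Sequent n
  idSeq a [] = []
  idSeq a (R ∷ Rs) = (⟨ R ⟩ atom a) ∷ idSeq a Rs

  infix 4 ⊢_
  infix 5 ⟨_⟩_
  data ⊢_ {n : ℕ} : Sequent n → Set₁ where
    exch : ∀ {Γ Δ} → Γ ↭ Δ → ⊢ Γ → ⊢ Δ
    id-ax : ∀ (a : Atom n) Rs → Partition Rs → ⊢ idSeq a Rs
    neg-r : ∀ {Γ R f A} → ⊢ Γ ++ [ ⟨ preimage f R ⟩ A ]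
          → ⊢ Γ ++ [ ⟨ R ⟩ neg f A ]
    imp-neg : ∀ {Γ R f U A B} → ¬ (U ∈U) R
            → ⊢ Γ ++ (⟨ preimage f R ⟩ A) ∷ [ ⟨ R ⟩ B ]
            → ⊢ Γ ++ [ ⟨ R ⟩ imp f U A B ]
    imp-pos : ∀ {Γ₁ Γ₂ R f U A B} → (U ∈U) R
            → ⊢ Γ₁ ++ [ ⟨ preimage f R ⟩ A ]
            → ⊢ Γ₂ ++ [ ⟨ R ⟩ B ]
            → ⊢ (Γ₁ ++ Γ₂) ++ [ ⟨ R ⟩ imp f U A B ]
    and-neg₁ : ∀ {Γ R U A B} → ¬ (U ∈U) R
             → ⊢ Γ ++ [ ⟨ R ⟩ A ] → ⊢ Γ ++ [ ⟨ R ⟩ and U A B ]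
    and-neg₂ : ∀ {Γ R U A B} → ¬ (U ∈U) R
             → ⊢ Γ ++ [ ⟨ R ⟩ B ] → ⊢ Γ ++ [ ⟨ R ⟩ and U A B ]
    and-pos : ∀ {Γ R U A B} → (U ∈U) R
            → ⊢ Γ ++ [ ⟨ R ⟩ A ] → ⊢ Γ ++ [ ⟨ R ⟩ B ]
            → ⊢ Γ ++ [ ⟨ R ⟩ and U A B ]
    bang-pos : ∀ {Γ R U A} → (U ∈U) R → WhyNot Γ
             → ⊢ Γ ++ [ ⟨ R ⟩ A ] → ⊢ Γ ++ [ ⟨ R ⟩ bang U A ]
    bang-weaken : ∀ {Γ R U A} → ¬ (U ∈U) R
                → ⊢ Γ → ⊢ Γ ++ [ ⟨ R ⟩ bang U A ]
    bang-derelict : ∀ {Γ R U A} → ¬ (U ∈U) R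
                  → ⊢ Γ ++ [ ⟨ R ⟩ A ] → ⊢ Γ ++ [ ⟨ R ⟩ bang U A ]
    bang-contract : ∀ {Γ R U A} → ¬ (U ∈U) R
                  → ⊢ Γ ++ (⟨ R ⟩ bang U A) ∷ [ ⟨ R ⟩ bang U A ]
                  → ⊢ Γ ++ [ ⟨ R ⟩ bang U A ]
    all-neg : ∀ {Γ R U A} (t : Term n) → ¬ (U ∈U) R
            → ⊢ Γ ++ [ ⟨ R ⟩ (A [0:= t ]) ] → ⊢ Γ ++ [ ⟨ R ⟩ all U A ]
    -- eigenvariable condition: the premise lives in scope suc n, with Γ
    -- weakened (so the bound variable, index 0, does not occur in Γ)
    all-pos : ∀ {Γ R U A} → (U ∈U) R
            → ⊢_ {suc n} (wkSeq Γ ++ [ ⟨ R ⟩ A ]) → ⊢ Γ ++ [ ⟨ R ⟩ all U A ]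

module Submission where

open import Defs
open import Data.Nat using (ℕ)
open import Data.List using ([_]; [])
open import Data.List.Relation.Unary.All using ([])
open import Data.List.Relation.Unary.Any using (here)
open import Data.List.Relation.Unary.AllPairs using ([]; _∷_)
open import Data.Unit using (tt)

-- Every ultrafilter contains 𝓡, so each connective is introduced by
-- its positive rule with empty context; the preimage of 𝓡 under any endomorphism
-- is 𝓡 again (definitionally), so the premises are instances of the induction hypothesis.

full-partition : (𝓡 : Set) → Partition 𝓡 [ Full 𝓡 ]
full-partition 𝓡 = record
  { nonempty = nonEmpty
  ; disjoint = [] ∷ []
  ; covers   = λ _ → here tt
  }

lemma8 : (𝓡 : Set) {n : ℕ} (A : Formula 𝓡 n) → ⊢_ 𝓡 [ ⟨_⟩_ (Full 𝓡) A ]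
lemma8 𝓡 (atom a)      = id-ax a [ Full 𝓡 ] (full-partition 𝓡)
lemma8 𝓡 (neg f A)     = neg-r {Γ = []} (lemma8 𝓡 A)
lemma8 𝓡 (and U A B)   = and-pos {Γ = []} (full U) (lemma8 𝓡 A) (lemma8 𝓡 B)
lemma8 𝓡 (imp f U A B) = imp-pos {Γ₁ = []} {Γ₂ = []} (full U) (lemma8 𝓡 A) (lemma8 𝓡 B)
lemma8 𝓡 (bang U A)    = bang-pos {Γ = []} (full U) [] (lemma8 𝓡 A)
lemma8 𝓡 (all U A)     = all-pos {Γ = []} (full U) (lemma8 𝓡 A)
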